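{- Let $p\equiv1\pmod4$ be prime, let $a$ be an integer with $(a,p)=1$, and let $S(y)=\sum_{\mu=0}^{p-1}\sum_{\nu=0}^{p-1}\mu\chi_\nu\big\lfloor\frac{a\mu+ay+\nu}{p}\big\rfloor$. Then $S(0)\equiv\frac12(\chi_a-1)\pmod 2$.
   Context: $\chi_\nu=\left(\frac{\nu}{p}\right)$ is the Legendre symbol mod $p$, and $\lfloor\cdot\rfloor$ is the floor function. -}

module Defs where

open import Data.Nat as ℕ using (ℕ; zero; suc)
open import Data.Nat.Primality using (Prime)
open import Data.Integer as ℤ using (ℤ; +_; _-_; _*_; _+_; _/ℕ_; _%ℕ_; -1ℤ; 0ℤ; 1ℤ)
open import Data.List using (List; upTo)
open import Data.Bool.ListAction using (any)
open import Data.Bool using (Bool; true; false; if_then_else_)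
open import Data.Nat using (_≡ᵇ_)

Σ[<_] : ℕ → (ℕ → ℤ) → ℤ
Σ[< zero ] f = 0ℤ
Σ[< suc n ] f = Σ[< n ] f + f n

isSquareMod : (p : ℕ) .{{_ : ℕ.NonZero p}} → ℤ → Bool
isSquareMod p ν = any (λ x → ((+ (x ℕ.* x)) %ℕ p) ≡ᵇ (ν %ℕ p)) (upTo p)

legendre : (p : ℕ) .{{_ : ℕ.NonZero p}} → ℤ → ℤ
legendre p ν =
  if (ν %ℕ p) ≡ᵇ 0 then 0ℤ
  else (if isSquareMod p ν then 1ℤ else -1ℤ)

S : (p : ℕ) .{{_ : ℕ.NonZero p}} → ℤ → ℤ → ℤ
S p a y = Σ[< p ] (λ μ → Σ[< p ] (λ ν →
  (+ μ) * legendre p (+ ν) * ((a * + μ + a * y + + ν) /ℕ p)))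

-- Reduce modulo 2.  There χ_ν ≡ 1 for p ∤ ν and χ_0 = 0, so by Hermite's identity
-- Σ_{ν<p} ⌊(x+ν)/p⌋ = x the inner sum over ν is x − ⌊x/p⌋ = ρ + (p − 1)⌊x/p⌋ ≡ ρ for x = aμ,
-- where ρ = ρ_μ is the residue of aμ mod p.  Hence S(0) ≡ Σ_μ μ ρ_μ.  Pairing μ with p − μ,
-- for which ρ_{p−μ} = p − ρ_μ, turns this into Σ_{μ=1}^{h} (1 + μ + ρ_μ), where p = 2h + 1.
-- Writing ρ_μ ≡ ±t_μ (mod p) with 1 ≤ t_μ ≤ h, the t_μ permute 1, …, h and ρ_μ ≡ t_μ + 1 exactly
-- when ρ_μ > h; as h is even for p ≡ 1 (mod 4), the sum is ≡ N = #{μ ≤ h : ρ_μ > h}.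
-- Gauss's lemma a^h ≡ (−1)^N and Euler's criterion a^h ≡ χ_a (mod p), the latter by pairing
-- each unit x with c/x in (p − 1)!, give (−1)^N = χ_a, that is N ≡ (χ_a − 1)/2 (mod 2).

module Submission where

open import Defs
open import Data.Nat as ℕ using (ℕ; _%_)
open import Data.Nat.Primality using (Prime)
open import Data.Integer as ℤ using (ℤ; +_; _-_; _/ℕ_; 1ℤ; 0ℤ)
open import Data.Integer.GCD using (gcd)
open import Data.Integer.Divisibility using (_∣_)
open import Relation.Binary.PropositionalEquality using (_≡_)

open import Algebra.Bundles using (CommutativeMonoid)
open import Data.Bool using (Bool; true; false; if_then_else_; T)
open import Data.Empty using (⊥)
open import Data.Integer using (-_; _+_; _*_; -1ℤ; _^_; _%ℕ_)
import Data.Integer.DivMod as ℤ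
open import Data.Integer.Divisibility.Signed as Signed
  using (divides; ∣m∣n⇒∣m+n; ∣m⇒∣-m; ∣m⇒∣m*n; ∣n⇒∣m*n)
import Data.Integer.Properties as ℤ
open import Data.Integer.Tactic.RingSolver using (solve-∀)
open import Data.List using (upTo)
open import Data.List.Membership.Propositional using (find; lose)
open import Data.List.Membership.Propositional.Properties using (∈-upTo⁺; ∈-upTo⁻)
open import Data.List.Relation.Unary.Any.Properties using (any⁺; any⁻)
open import Data.Nat using (zero; suc; NonZero; z≤n; s≤s; _<_; _≤_)
open import Data.Nat.Coprimality using (coprime⇒gcd≡1; prime⇒coprime)
import Data.Nat.DivMod as ℕ
import Data.Nat.Divisibility as ℕ
import Data.Nat.GCD as ℕ
open import Data.Nat.GCD using (gcd-GCD; module Bézout)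
open import Data.Nat.Primality using (euclidsLemma; prime⇒nonTrivial)
import Data.Nat.Properties as ℕ
open import Data.Product using (_×_; _,_; ∃; proj₁; proj₂)
open import Data.Sum as Sum using (_⊎_; inj₁; inj₂)
open import Function using (_∘_; _$_)
open import Relation.Binary.Bundles using (Setoid)
open import Relation.Binary.PropositionalEquality
  using (refl; sym; trans; cong; cong₂; subst; _≢_; module ≡-Reasoning)
import Relation.Binary.Reasoning.Setoid
open import Relation.Binary.Structures using (IsEquivalence)
open import Relation.Nullary using (¬_; yes; no; contradiction)
open import Relation.Nullary.Reflects using (ofʸ; ofⁿ)
open import Algebra.Properties.AbelianGroup ℤ.+-0-abelianGroup using () renaming (∙-cancelˡ to +-cancelˡ)

-- Congruences of integers

infix 4 _≡_mod_

-- A record rather than a synonym for divisibility, so that x and y can be inferred.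
record _≡_mod_ (x y : ℤ) (m : ℕ) : Set where
  constructor ∣⇒≡-mod
  field ≡-mod⇒∣ : + m Signed.∣ x - y
open _≡_mod_ public

module _ {m : ℕ} where

  mod-reflexive : ∀ {x y} → x ≡ y → x ≡ y mod m
  mod-reflexive {x} refl = ∣⇒≡-mod $ divides 0ℤ (trans (ℤ.+-inverseʳ x) (sym (ℤ.*-zeroˡ (+ m))))

  mod-refl : ∀ {x} → x ≡ x mod m
  mod-refl = mod-reflexive refl

  mod-sym : ∀ {x y} → x ≡ y mod m → y ≡ x mod m
  mod-sym {x} {y} x≡y = ∣⇒≡-mod $ subst (+ m Signed.∣_) (negate x y) (∣m⇒∣-m (≡-mod⇒∣ x≡y))
    where
    negate : ∀ x y → - (x - y) ≡ y - x
    negate = solve-∀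

  mod-trans : ∀ {x y z} → x ≡ y mod m → y ≡ z mod m → x ≡ z mod m
  mod-trans {x} {y} {z} x≡y y≡z =
    ∣⇒≡-mod $ subst (+ m Signed.∣_) (ℤ.+-minus-telescope x y z)
                (∣m∣n⇒∣m+n (≡-mod⇒∣ x≡y) (≡-mod⇒∣ y≡z))

  +-cong-mod : ∀ {x y u v} → x ≡ y mod m → u ≡ v mod m → x + u ≡ y + v mod m
  +-cong-mod {x} {y} {u} {v} x≡y u≡v =
    ∣⇒≡-mod $ subst (+ m Signed.∣_) (regroup x y u v) (∣m∣n⇒∣m+n (≡-mod⇒∣ x≡y) (≡-mod⇒∣ u≡v))
    where
    regroup : ∀ x y u v → (x - y) + (u - v) ≡ (x + u) - (y + v)
    regroup = solve-∀

  *-cong-mod : ∀ {x y u v} → x ≡ y mod m → u ≡ v mod m → x * u ≡ y * v mod m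
  *-cong-mod {x} {y} {u} {v} x≡y u≡v =
    ∣⇒≡-mod $ subst (+ m Signed.∣_) (regroup x y u v)
                (∣m∣n⇒∣m+n (∣m⇒∣m*n u (≡-mod⇒∣ x≡y)) (∣n⇒∣m*n y (≡-mod⇒∣ u≡v)))
    where
    regroup : ∀ x y u v → (x - y) * u + y * (u - v) ≡ x * u - y * v
    regroup = solve-∀

  *-congˡ-mod : ∀ x {y z} → y ≡ z mod m → x * y ≡ x * z mod m
  *-congˡ-mod x = *-cong-mod (mod-refl {x})

  *-congʳ-mod : ∀ z {x y} → x ≡ y mod m → x * z ≡ y * z mod m
  *-congʳ-mod z x≡y = *-cong-mod x≡y (mod-refl {z})

  neg-cong-mod : ∀ {x y} → x ≡ y mod m → - x ≡ - y mod m
  neg-cong-mod {x} {y} x≡y = ∣⇒≡-mod $ subst (+ m Signed.∣_) (negate x y) (∣m⇒∣-m (≡-mod⇒∣ x≡y))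
    where
    negate : ∀ x y → - (x - y) ≡ - x - - y
    negate = solve-∀

  multiple≡0-mod : ∀ k → k * + m ≡ 0ℤ mod m
  multiple≡0-mod k = ∣⇒≡-mod $ divides k (ℤ.+-identityʳ (k * + m))

  mod-isEquivalence : IsEquivalence (λ x y → x ≡ y mod m)
  mod-isEquivalence = record { refl = mod-refl ; sym = mod-sym ; trans = mod-trans }

mod-setoid : ℕ → Setoid _ _
mod-setoid m = record { isEquivalence = mod-isEquivalence {m} }

module ≡-mod-Reasoning (m : ℕ) = Relation.Binary.Reasoning.Setoid (mod-setoid m)

module _ {m : ℕ} where

  i≡j⇒i-j≡0-mod : ∀ {x y} → x ≡ y mod m → x - y ≡ 0ℤ mod m
  i≡j⇒i-j≡0-mod {x} {y} (∣⇒≡-mod m∣x-y) =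
    ∣⇒≡-mod (subst (+ m Signed.∣_) (sym (ℤ.+-identityʳ (x - y))) m∣x-y)

  i-j≡0⇒i≡j-mod : ∀ {x y} → x - y ≡ 0ℤ mod m → x ≡ y mod m
  i-j≡0⇒i≡j-mod {x} {y} (∣⇒≡-mod m∣x-y-0) =
    ∣⇒≡-mod (subst (+ m Signed.∣_) (ℤ.+-identityʳ (x - y)) m∣x-y-0)

  ≡0-mod⇒∣ : ∀ {x} → x ≡ 0ℤ mod m → m ℕ.∣ ℤ.∣ x ∣
  ≡0-mod⇒∣ {x} (∣⇒≡-mod m∣x-0) =
    subst (λ y → m ℕ.∣ ℤ.∣ y ∣) (ℤ.+-identityʳ x) (Signed.∣⇒∣ᵤ m∣x-0)

  ∣⇒≡0-mod : ∀ {x} → m ℕ.∣ ℤ.∣ x ∣ → x ≡ 0ℤ mod m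
  ∣⇒≡0-mod {x} m∣x =
    ∣⇒≡-mod (Signed.∣ᵤ⇒∣ (subst (λ y → m ℕ.∣ ℤ.∣ y ∣) (sym (ℤ.+-identityʳ x)) m∣x))

  residue-unique : ∀ {r s} → r < m → s < m → + r ≡ + s mod m → r ≡ s
  residue-unique {r} {s} r<m s<m r≡s =
    ℤ.+-injective (ℤ.i-j≡0⇒i≡j (+ r) (+ s)
      (ℤ.∣i∣≡0⇒i≡0 (multiple<⇒≡0 ∣r-s∣<m (≡0-mod⇒∣ (i≡j⇒i-j≡0-mod r≡s)))))
    where
    multiple<⇒≡0 : ∀ {d} → d < m → m ℕ.∣ d → d ≡ 0
    multiple<⇒≡0 {zero}  _   _   = refl
    multiple<⇒≡0 {suc _} d<m m∣d = contradiction m∣d (ℕ.>⇒∤ d<m)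
    ∣r-s∣<m : ℤ.∣ + r - + s ∣ < m
    ∣r-s∣<m = subst (_< m) (cong ℤ.∣_∣ (sym (ℤ.m-n≡m⊖n r s)))
                (ℕ.≤-<-trans (ℤ.∣m⊝n∣≤m⊔n r s) (ℕ.⊔-pres-<m r<m s<m))

  nonzero-residue : ∀ {r} → 0 < r → r < m → ¬ (+ r ≡ 0ℤ mod m)
  nonzero-residue {r} 0<r r<m r≡0 = ℕ.<⇒≢ 0<r (sym (residue-unique r<m (ℕ.<-trans 0<r r<m) r≡0))

  m∸n≡-n-mod : ∀ {y} → y ≤ m → + (m ℕ.∸ y) ≡ - + y mod m
  m∸n≡-n-mod {y} y≤m = ∣⇒≡-mod (divides 1ℤ (begin
    + (m ℕ.∸ y) - - + y   ≡⟨ cong (λ k → + (m ℕ.∸ y) + k) (ℤ.neg-involutive (+ y)) ⟩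
    + (m ℕ.∸ y) + + y     ≡⟨ ℤ.pos-+ (m ℕ.∸ y) y ⟨
    + (m ℕ.∸ y ℕ.+ y)     ≡⟨ cong +_ (ℕ.m∸n+n≡m y≤m) ⟩
    + m                   ≡⟨ ℤ.*-identityˡ (+ m) ⟨
    1ℤ * + m              ∎))
    where open ≡-Reasoning

1≢-1-mod : ∀ {m} → 2 < m → ¬ (1ℤ ≡ -1ℤ mod m)
1≢-1-mod 2<m 1≡-1 = nonzero-residue (s≤s z≤n) 2<m (i≡j⇒i-j≡0-mod 1≡-1)

gcd≡1⇒≢0-mod : ∀ {a m} → gcd a (+ m) ≡ 1ℤ → m ≢ 1 → ¬ (a ≡ 0ℤ mod m)
gcd≡1⇒≢0-mod {a} {m} gcd≡1 m≢1 a≡0 =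
  m≢1 (ℕ.∣1⇒≡1 (subst (m ℕ.∣_) (ℤ.+-injective gcd≡1) (ℕ.gcd-greatest (≡0-mod⇒∣ a≡0) ℕ.∣-refl)))

module _ {m : ℕ} .{{_ : NonZero m}} where

  a≡a%ℕn-mod : ∀ x → x ≡ + (x %ℕ m) mod m
  a≡a%ℕn-mod x = ∣⇒≡-mod (divides (x /ℕ m) (begin
    x - + (x %ℕ m)                              ≡⟨ cong (_- + (x %ℕ m)) (ℤ.a≡a%ℕn+[a/ℕn]*n x m) ⟩
    (+ (x %ℕ m) + (x /ℕ m) * + m) - + (x %ℕ m)  ≡⟨ cancel (+ (x %ℕ m)) ((x /ℕ m) * + m) ⟩
    (x /ℕ m) * + m                              ∎))
    where
    open ≡-Reasoning
    cancel : ∀ r k → (r + k) - r ≡ k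
    cancel = solve-∀

  %ℕ<m : ∀ x → x %ℕ m < m
  %ℕ<m x = ℤ.n%ℕd<d x m

  /ℕ-unique : ∀ {x r} q → r < m → x ≡ + r + q * + m → x /ℕ m ≡ q
  /ℕ-unique {x} {r} q r<m x≡r+qm = ℤ.*-cancelʳ-≡ (x /ℕ m) q (+ m) (+-cancelˡ (+ r) _ _ (begin
    + r + (x /ℕ m) * + m
      ≡⟨ cong (λ s → + s + (x /ℕ m) * + m) (residue-unique r<m (%ℕ<m x) (mod-trans (mod-sym x≡r) (a≡a%ℕn-mod x))) ⟩
    + (x %ℕ m) + (x /ℕ m) * + m
      ≡⟨ ℤ.a≡a%ℕn+[a/ℕn]*n x m ⟨
    x
      ≡⟨ x≡r+qm ⟩
    + r + q * + m ∎))
    where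
    open ≡-Reasoning
    x≡r : x ≡ + r mod m
    x≡r = subst (_≡ + r mod m) (sym x≡r+qm)
            (mod-trans (+-cong-mod (mod-refl {x = + r}) (multiple≡0-mod q)) (mod-reflexive (ℤ.+-identityʳ (+ r))))

-- Finite sums and products

transpose : ℕ → ℕ → ℕ → ℕ
transpose i j k with k ℕ.≟ i
... | yes _ = j
... | no _ with k ℕ.≟ j
...   | yes _ = i
...   | no _  = k

transpose-left : ∀ i j → transpose i j i ≡ j
transpose-left i j with i ℕ.≟ i
... | yes _  = refl
... | no i≢i = contradiction refl i≢i

transpose-right : ∀ i j → transpose i j j ≡ i
transpose-right i j with j ℕ.≟ i
... | yes j≡i = j≡i
... | no _ with j ℕ.≟ j
...   | yes _  = refl
...   | no j≢j = contradiction refl j≢j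

transpose-other : ∀ {i j k} → k ≢ i → k ≢ j → transpose i j k ≡ k
transpose-other {i} {j} {k} k≢i k≢j with k ℕ.≟ i
... | yes k≡i = contradiction k≡i k≢i
... | no _ with k ℕ.≟ j
...   | yes k≡j = contradiction k≡j k≢j
...   | no _    = refl

transpose-involutive : ∀ i j k → transpose i j (transpose i j k) ≡ k
transpose-involutive i j k with k ℕ.≟ i
... | yes refl = transpose-right i j
... | no k≢i with k ℕ.≟ j
...   | yes refl = transpose-left i j
...   | no k≢j   = transpose-other k≢i k≢j

transpose-injective : ∀ i j {k l} → transpose i j k ≡ transpose i j l → k ≡ l
transpose-injective i j {k} {l} τk≡τl = begin
  k                             ≡⟨ transpose-involutive i j k ⟨
  transpose i j (transpose i j k) ≡⟨ cong (transpose i j) τk≡τl ⟩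
  transpose i j (transpose i j l) ≡⟨ transpose-involutive i j l ⟩
  l                             ∎
  where open ≡-Reasoning

record IsPermutation (n : ℕ) (σ : ℕ → ℕ) : Set where
  field
    maps-below      : ∀ {i} → i < n → σ i < n
    injective-below : ∀ {i j} → i < n → j < n → σ i ≡ σ j → i ≡ j

module _ {c ℓ} (M : CommutativeMonoid c ℓ) where

  open CommutativeMonoid M
    using (Carrier; _≈_; _∙_; ε; setoid; commutativeSemigroup;
           ∙-cong; ∙-congʳ; ∙-congˡ; identityˡ; identityʳ; assoc)
    renaming (sym to ≈-sym; trans to ≈-trans; reflexive to ≈-reflexive)

  -- The fold is a parameter, given by its recursion equations, so that Σ[<_] of Defs is an instance.
  module BigOperator (⨁ : ℕ → (ℕ → Carrier) → Carrier)
                     (⨁-zero : ∀ f → ⨁ zero f ≈ ε)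
                     (⨁-suc : ∀ n f → ⨁ (suc n) f ≈ ⨁ n f ∙ f n) where

    open import Relation.Binary.Reasoning.Setoid setoid
    open import Algebra.Properties.CommutativeSemigroup commutativeSemigroup using (interchange; xy∙z≈xz∙y)

    ⨁-cong : ∀ n {f g} → (∀ {i} → i < n → f i ≈ g i) → ⨁ n f ≈ ⨁ n g
    ⨁-cong zero {f} {g} _ = ≈-trans (⨁-zero f) (≈-sym (⨁-zero g))
    ⨁-cong (suc n) {f} {g} f≈g = begin
      ⨁ (suc n) f  ≈⟨ ⨁-suc n f ⟩
      ⨁ n f ∙ f n  ≈⟨ ∙-cong (⨁-cong n (f≈g ∘ ℕ.m<n⇒m<1+n)) (f≈g (ℕ.n<1+n n)) ⟩
      ⨁ n g ∙ g n  ≈⟨ ⨁-suc n g ⟨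
      ⨁ (suc n) g  ∎

    ⨁-distrib : ∀ n f g → ⨁ n (λ i → f i ∙ g i) ≈ ⨁ n f ∙ ⨁ n g
    ⨁-distrib zero f g = begin
      ⨁ zero _          ≈⟨ ⨁-zero _ ⟩
      ε                 ≈⟨ identityʳ ε ⟨
      ε ∙ ε             ≈⟨ ∙-cong (⨁-zero f) (⨁-zero g) ⟨
      ⨁ zero f ∙ ⨁ zero g ∎
    ⨁-distrib (suc n) f g = begin
      ⨁ (suc n) _                       ≈⟨ ⨁-suc n _ ⟩
      ⨁ n (λ i → f i ∙ g i) ∙ (f n ∙ g n) ≈⟨ ∙-congʳ (⨁-distrib n f g) ⟩
      (⨁ n f ∙ ⨁ n g) ∙ (f n ∙ g n)       ≈⟨ interchange _ _ _ _ ⟩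
      (⨁ n f ∙ f n) ∙ (⨁ n g ∙ g n)       ≈⟨ ∙-cong (⨁-suc n f) (⨁-suc n g) ⟨
      ⨁ (suc n) f ∙ ⨁ (suc n) g           ∎

    ⨁-split : ∀ m n f → ⨁ (m ℕ.+ n) f ≈ ⨁ m f ∙ ⨁ n (λ i → f (m ℕ.+ i))
    ⨁-split m zero f = begin
      ⨁ (m ℕ.+ zero) f       ≡⟨ cong (λ k → ⨁ k f) (ℕ.+-identityʳ m) ⟩
      ⨁ m f                  ≈⟨ identityʳ (⨁ m f) ⟨
      ⨁ m f ∙ ε              ≈⟨ ∙-congˡ (⨁-zero _) ⟨
      ⨁ m f ∙ ⨁ zero _       ∎
    ⨁-split m (suc n) f = begin
      ⨁ (m ℕ.+ suc n) f                               ≡⟨ cong (λ k → ⨁ k f) (ℕ.+-suc m n) ⟩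
      ⨁ (suc (m ℕ.+ n)) f                             ≈⟨ ⨁-suc (m ℕ.+ n) f ⟩
      ⨁ (m ℕ.+ n) f ∙ f (m ℕ.+ n)                     ≈⟨ ∙-congʳ (⨁-split m n f) ⟩
      (⨁ m f ∙ ⨁ n (λ i → f (m ℕ.+ i))) ∙ f (m ℕ.+ n) ≈⟨ assoc _ _ _ ⟩
      ⨁ m f ∙ (⨁ n (λ i → f (m ℕ.+ i)) ∙ f (m ℕ.+ n)) ≈⟨ ∙-congˡ (⨁-suc n _) ⟨
      ⨁ m f ∙ ⨁ (suc n) (λ i → f (m ℕ.+ i))           ∎

    ⨁-shift : ∀ n f → ⨁ (suc n) f ≈ f 0 ∙ ⨁ n (f ∘ suc)
    ⨁-shift n f = begin
      ⨁ (suc n) f             ≈⟨ ⨁-split 1 n f ⟩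
      ⨁ 1 f ∙ ⨁ n (f ∘ suc)   ≈⟨ ∙-congʳ (⨁-suc 0 f) ⟩
      (⨁ 0 f ∙ f 0) ∙ ⨁ n (f ∘ suc) ≈⟨ ∙-congʳ (∙-congʳ (⨁-zero f)) ⟩
      (ε ∙ f 0) ∙ ⨁ n (f ∘ suc) ≈⟨ ∙-congʳ (identityˡ (f 0)) ⟩
      f 0 ∙ ⨁ n (f ∘ suc)     ∎

    ⨁-update : ∀ {n f g k} → k < n → (∀ {i} → i < n → i ≢ k → f i ≈ g i) →
               ⨁ n f ∙ g k ≈ ⨁ n g ∙ f k
    ⨁-update {suc n} {f} {g} {k} k<1+n f≈g with ℕ.m<1+n⇒m<n∨m≡n k<1+n
    ... | inj₂ refl = begin
      ⨁ (suc n) f ∙ g n   ≈⟨ ∙-congʳ (⨁-suc n f) ⟩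
      (⨁ n f ∙ f n) ∙ g n ≈⟨ xy∙z≈xz∙y _ _ _ ⟩
      (⨁ n f ∙ g n) ∙ f n ≈⟨ ∙-congʳ (∙-congʳ (⨁-cong n (λ i<n → f≈g (ℕ.m<n⇒m<1+n i<n) (ℕ.<⇒≢ i<n)))) ⟩
      (⨁ n g ∙ g n) ∙ f n ≈⟨ ∙-congʳ (⨁-suc n g) ⟨
      ⨁ (suc n) g ∙ f n   ∎
    ... | inj₁ k<n = begin
      ⨁ (suc n) f ∙ g k   ≈⟨ ∙-congʳ (⨁-suc n f) ⟩
      (⨁ n f ∙ f n) ∙ g k ≈⟨ xy∙z≈xz∙y _ _ _ ⟩
      (⨁ n f ∙ g k) ∙ f n ≈⟨ ∙-cong (⨁-update k<n (f≈g ∘ ℕ.m<n⇒m<1+n)) (f≈g (ℕ.n<1+n n) (ℕ.>⇒≢ k<n)) ⟩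
      (⨁ n g ∙ f k) ∙ g n ≈⟨ xy∙z≈xz∙y _ _ _ ⟩
      (⨁ n g ∙ g n) ∙ f k ≈⟨ ∙-congʳ (⨁-suc n g) ⟨
      ⨁ (suc n) g ∙ f k   ∎

    ⨁-transpose : ∀ {m k} g → k ≤ m → ⨁ m (g ∘ transpose k m) ∙ g k ≈ ⨁ m g ∙ g m
    ⨁-transpose {m} {k} g k≤m with ℕ.m≤n⇒m<n∨m≡n k≤m
    ... | inj₁ k<m = begin
      ⨁ m (g ∘ transpose k m) ∙ g k
        ≈⟨ ⨁-update k<m (λ i<m i≢k → ≈-reflexive (cong g (transpose-other i≢k (ℕ.<⇒≢ i<m)))) ⟩
      ⨁ m g ∙ g (transpose k m k)
        ≡⟨ cong (λ i → ⨁ m g ∙ g i) (transpose-left k m) ⟩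
      ⨁ m g ∙ g m ∎
    ... | inj₂ refl =
      ∙-congʳ (⨁-cong m (λ i<m → ≈-reflexive (cong g (transpose-other (ℕ.<⇒≢ i<m) (ℕ.<⇒≢ i<m)))))

    -- Composing σ with the transposition of σ m and m fixes m and leaves a permutation of [0, m).
    ⨁-permute : ∀ n {σ} → IsPermutation n σ → ∀ g → ⨁ n (g ∘ σ) ≈ ⨁ n g
    ⨁-permute zero _ g = ≈-trans (⨁-zero _) (≈-sym (⨁-zero g))
    ⨁-permute (suc m) {σ} σ-perm g = begin
      ⨁ (suc m) (g ∘ σ)
        ≈⟨ ⨁-suc m (g ∘ σ) ⟩
      ⨁ m (g ∘ σ) ∙ g (σ m)
        ≈⟨ ∙-congʳ (⨁-cong m (λ {i} _ → ≈-reflexive (cong g (sym (transpose-involutive (σ m) m (σ i)))))) ⟩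
      ⨁ m ((g ∘ τ) ∘ (τ ∘ σ)) ∙ g (σ m)
        ≈⟨ ∙-congʳ (⨁-permute m τσ-perm (g ∘ τ)) ⟩
      ⨁ m (g ∘ τ) ∙ g (σ m)
        ≈⟨ ⨁-transpose g (ℕ.≤-pred (maps-below (ℕ.n<1+n m))) ⟩
      ⨁ m g ∙ g m
        ≈⟨ ⨁-suc m g ⟨
      ⨁ (suc m) g ∎
      where
      open IsPermutation σ-perm
      τ : ℕ → ℕ
      τ = transpose (σ m) m
      τσ-perm : IsPermutation m (τ ∘ σ)
      τσ-perm = record { maps-below = τσ-below ; injective-below = τσ-injective }
        where
        lift : ∀ {i} → i < m → i < suc m
        lift = ℕ.m<n⇒m<1+n
        σ≢σm : ∀ {i} → i < m → σ i ≢ σ m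
        σ≢σm i<m σi≡σm = ℕ.<⇒≢ i<m (injective-below (lift i<m) (ℕ.n<1+n m) σi≡σm)
        below-m : ∀ {k} → k < suc m → k ≢ m → k < m
        below-m k<1+m = ℕ.≤∧≢⇒< (ℕ.≤-pred k<1+m)
        τσ-below : ∀ {i} → i < m → τ (σ i) < m
        τσ-below {i} i<m with σ i ℕ.≟ m
        ... | no σi≢m = subst (_< m) (sym (transpose-other (σ≢σm i<m) σi≢m))
                          (below-m (maps-below (lift i<m)) σi≢m)
        ... | yes σi≡m = subst (_< m) (sym (trans (cong τ σi≡m) (transpose-right (σ m) m)))
                           (below-m (maps-below (ℕ.n<1+n m)) (λ σm≡m → σ≢σm i<m (trans σi≡m (sym σm≡m))))
        τσ-injective : ∀ {i j} → i < m → j < m → τ (σ i) ≡ τ (σ j) → i ≡ j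
        τσ-injective i<m j<m = injective-below (lift i<m) (lift j<m) ∘ transpose-injective (σ m) m

Π[<_] : ℕ → (ℕ → ℤ) → ℤ
Π[< zero ] f = 1ℤ
Π[< suc n ] f = Π[< n ] f * f n

open BigOperator ℤ.+-0-commutativeMonoid Σ[<_] (λ _ → refl) (λ _ _ → refl) using ()
  renaming (⨁-cong to Σ-cong; ⨁-distrib to Σ-distrib; ⨁-split to Σ-split; ⨁-shift to Σ-shift;
            ⨁-permute to Σ-permute)
open BigOperator ℤ.*-1-commutativeMonoid Π[<_] (λ _ → refl) (λ _ _ → refl) using ()
  renaming (⨁-cong to Π-cong; ⨁-distrib to Π-distrib; ⨁-update to Π-update; ⨁-permute to Π-permute)

Σ-cong-mod : ∀ {m} n {f g} → (∀ {i} → i < n → f i ≡ g i mod m) → Σ[< n ] f ≡ Σ[< n ] g mod m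
Σ-cong-mod zero    _   = mod-refl
Σ-cong-mod (suc n) f≡g = +-cong-mod (Σ-cong-mod n (f≡g ∘ ℕ.m<n⇒m<1+n)) (f≡g (ℕ.n<1+n n))

Π-cong-mod : ∀ {m} n {f g} → (∀ {i} → i < n → f i ≡ g i mod m) → Π[< n ] f ≡ Π[< n ] g mod m
Π-cong-mod zero    _   = mod-refl
Π-cong-mod (suc n) f≡g = *-cong-mod (Π-cong-mod n (f≡g ∘ ℕ.m<n⇒m<1+n)) (f≡g (ℕ.n<1+n n))

Σ-*ˡ : ∀ n k f → Σ[< n ] (λ i → k * f i) ≡ k * Σ[< n ] f
Σ-*ˡ zero    k f = sym (ℤ.*-zeroʳ k)
Σ-*ˡ (suc n) k f = trans (cong (_+ k * f n) (Σ-*ˡ n k f)) (sym (ℤ.*-distribˡ-+ k (Σ[< n ] f) (f n)))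

Σ-const : ∀ n c → Σ[< n ] (λ _ → c) ≡ + n * c
Σ-const zero    c = sym (ℤ.*-zeroˡ c)
Σ-const (suc n) c = begin
  Σ[< n ] (λ _ → c) + c ≡⟨ cong (_+ c) (Σ-const n c) ⟩
  + n * c + c           ≡⟨ ℤ.+-comm (+ n * c) c ⟩
  c + + n * c           ≡⟨ ℤ.suc-* (+ n) c ⟨
  + suc n * c           ∎
  where open ≡-Reasoning

Π-const : ∀ n c → Π[< n ] (λ _ → c) ≡ c ^ n
Π-const zero    c = refl
Π-const (suc n) c = trans (cong (_* c) (Π-const n c)) (ℤ.*-comm (c ^ n) c)

sign : Bool → ℤ
sign b = if b then -1ℤ else 1ℤ

indicator : Bool → ℤ
indicator b = if b then 1ℤ else 0ℤ

sign-squared : ∀ b → sign b * sign b ≡ 1ℤ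
sign-squared true  = refl
sign-squared false = refl

Π-sign-parity : ∀ n (b : ℕ → Bool) →
  (Π[< n ] (sign ∘ b) ≡ 1ℤ)  × (Σ[< n ] (indicator ∘ b) ≡ 0ℤ mod 2) ⊎
  (Π[< n ] (sign ∘ b) ≡ -1ℤ) × (Σ[< n ] (indicator ∘ b) ≡ 1ℤ mod 2)
Π-sign-parity zero    b = inj₁ (refl , mod-refl)
Π-sign-parity (suc n) b with Π-sign-parity n b | b n
... | inj₁ (Π≡1 , Σ≡0)  | false = inj₁ (cong (_* 1ℤ) Π≡1 , +-cong-mod Σ≡0 mod-refl)
... | inj₁ (Π≡1 , Σ≡0)  | true  = inj₂ (cong (_* -1ℤ) Π≡1 , +-cong-mod Σ≡0 mod-refl)
... | inj₂ (Π≡-1 , Σ≡1) | false = inj₂ (cong (_* 1ℤ) Π≡-1 , +-cong-mod Σ≡1 mod-refl)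
... | inj₂ (Π≡-1 , Σ≡1) | true  =
  inj₁ (cong (_* -1ℤ) Π≡-1 , mod-trans (+-cong-mod Σ≡1 mod-refl) (multiple≡0-mod 1ℤ))

sign-count-parity : ∀ {m χ} n (b : ℕ → Bool) → ¬ (1ℤ ≡ -1ℤ mod m) → χ ≡ 1ℤ ⊎ χ ≡ -1ℤ →
                    χ ≡ Π[< n ] (sign ∘ b) mod m → Σ[< n ] (indicator ∘ b) ≡ (χ - 1ℤ) /ℕ 2 mod 2
sign-count-parity n b 1≢-1 χ≡±1 χ≡Π with χ≡±1 | Π-sign-parity n b
... | inj₁ refl | inj₁ (_ , N≡0)    = N≡0
... | inj₂ refl | inj₂ (_ , N≡1)    = mod-trans N≡1 (∣⇒≡-mod (divides 1ℤ refl))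
... | inj₁ refl | inj₂ (Π≡-1 , _)  = contradiction (mod-trans χ≡Π (mod-reflexive Π≡-1)) 1≢-1
... | inj₂ refl | inj₁ (Π≡1 , _)   = contradiction (mod-sym (mod-trans χ≡Π (mod-reflexive Π≡1))) 1≢-1

-- Arithmetic modulo a prime

inverse : ℕ → ℕ → ℤ
inverse p x with Bézout.identity (gcd-GCD p x)
... | Bézout.+- _ v _ = - + v
... | Bézout.-+ _ v _ = + v

module _ {p : ℕ} (p-prime : Prime p) where

  euclid-mod : ∀ {x y} → x * y ≡ 0ℤ mod p → x ≡ 0ℤ mod p ⊎ y ≡ 0ℤ mod p
  euclid-mod {x} {y} xy≡0 = Sum.map ∣⇒≡0-mod ∣⇒≡0-mod
    (euclidsLemma ℤ.∣ x ∣ ℤ.∣ y ∣ p-prime (subst (p ℕ.∣_) (ℤ.abs-* x y) (≡0-mod⇒∣ xy≡0)))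

  *-cancelˡ-mod : ∀ {c x y} → ¬ (c ≡ 0ℤ mod p) → c * x ≡ c * y mod p → x ≡ y mod p
  *-cancelˡ-mod {c} {x} {y} c≢0 cx≡cy with euclid-mod (subst (_≡ 0ℤ mod p) (factor c x y) (i≡j⇒i-j≡0-mod cx≡cy))
    where
    factor : ∀ c x y → c * x - c * y ≡ c * (x - y)
    factor = solve-∀
  ... | inj₁ c≡0   = contradiction c≡0 c≢0
  ... | inj₂ x-y≡0 = i-j≡0⇒i≡j-mod x-y≡0

  square-roots-mod : ∀ {x y} → x * x ≡ y * y mod p → x ≡ y mod p ⊎ x ≡ - y mod p
  square-roots-mod {x} {y} xx≡yy with euclid-mod (subst (_≡ 0ℤ mod p) (factor x y) (i≡j⇒i-j≡0-mod xx≡yy))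
    where
    factor : ∀ x y → x * x - y * y ≡ (x - y) * (x - - y)
    factor = solve-∀
  ... | inj₁ x-y≡0  = inj₁ (i-j≡0⇒i≡j-mod x-y≡0)
  ... | inj₂ x+y≡0  = inj₂ (i-j≡0⇒i≡j-mod x+y≡0)

  Π-≢0-mod : ∀ n f → (∀ {i} → i < n → ¬ (f i ≡ 0ℤ mod p)) → ¬ (Π[< n ] f ≡ 0ℤ mod p)
  Π-≢0-mod zero    f _   1≡0 =
    ℕ.<⇒≢ (ℕ.nonTrivial⇒n>1 p {{prime⇒nonTrivial p-prime}}) (sym (ℕ.∣1⇒≡1 (≡0-mod⇒∣ 1≡0)))
  Π-≢0-mod (suc n) f f≢0 Πf≡0 with euclid-mod Πf≡0
  ... | inj₁ Π≡0 = Π-≢0-mod n f (f≢0 ∘ ℕ.m<n⇒m<1+n) Π≡0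
  ... | inj₂ f≡0 = f≢0 (ℕ.n<1+n n) f≡0

  coprime-Bézout-ℤ : ∀ {x} a b c d → 0 < x → x < p →
                     ℕ.gcd p x ℕ.+ a ℕ.* b ≡ c ℕ.* d → 1ℤ + + a * + b ≡ + c * + d
  coprime-Bézout-ℤ {x} a b c d 0<x x<p eq = begin
    1ℤ + + a * + b    ≡⟨ cong (λ k → 1ℤ + k) (ℤ.pos-* a b) ⟨
    + (1 ℕ.+ a ℕ.* b) ≡⟨ cong +_ (subst (λ g → g ℕ.+ a ℕ.* b ≡ c ℕ.* d) gcd≡1 eq) ⟩
    + (c ℕ.* d)       ≡⟨ ℤ.pos-* c d ⟩
    + c * + d         ∎
    where
    open ≡-Reasoning
    gcd≡1 : ℕ.gcd p x ≡ 1
    gcd≡1 = coprime⇒gcd≡1 (prime⇒coprime p-prime {{ℕ.>-nonZero 0<x}} x<p)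

  inverse-correct : ∀ {x} → 0 < x → x < p → + x * inverse p x ≡ 1ℤ mod p
  inverse-correct {x} 0<x x<p with Bézout.identity (gcd-GCD p x)
  ... | Bézout.+- u v eq = ∣⇒≡-mod (divides (- + u) (begin
    + x * - + v - 1ℤ   ≡⟨ rearrange (+ x) (+ v) ⟩
    - (1ℤ + + v * + x) ≡⟨ cong -_ (coprime-Bézout-ℤ v x u p 0<x x<p eq) ⟩
    - (+ u * + p)      ≡⟨ ℤ.neg-distribˡ-* (+ u) (+ p) ⟩
    - + u * + p        ∎))
    where
    open ≡-Reasoning
    rearrange : ∀ x v → x * - v - 1ℤ ≡ - (1ℤ + v * x)
    rearrange = solve-∀
  ... | Bézout.-+ u v eq = ∣⇒≡-mod (divides (+ u) (begin
    + x * + v - 1ℤ        ≡⟨ cong (_- 1ℤ) (ℤ.*-comm (+ x) (+ v)) ⟩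
    + v * + x - 1ℤ        ≡⟨ cong (_- 1ℤ) (coprime-Bézout-ℤ u p v x 0<x x<p eq) ⟨
    (1ℤ + + u * + p) - 1ℤ ≡⟨ cancel (+ u * + p) ⟩
    + u * + p             ∎))
    where
    open ≡-Reasoning
    cancel : ∀ k → (1ℤ + k) - 1ℤ ≡ k
    cancel = solve-∀

-- Products over subsets, and Euler's criterion

∏[_]<_ : (ℕ → Bool) → ℕ → ℤ
∏[ A ]< n = Π[< n ] (λ x → if A x then + x else 1ℤ)

#[_]<_ : (ℕ → Bool) → ℕ → ℕ
#[ A ]< zero  = 0
#[ A ]< suc n = (if A n then 1 else 0) ℕ.+ #[ A ]< n

infixl 6 _∖_

_∖_ : (ℕ → Bool) → ℕ → ℕ → Bool
(A ∖ x) y with y ℕ.≟ x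
... | yes _ = false
... | no _  = A y

∖-self : ∀ A x → (A ∖ x) x ≡ false
∖-self A x with x ℕ.≟ x
... | yes _  = refl
... | no x≢x = contradiction refl x≢x

∖-other : ∀ A {x y} → y ≢ x → (A ∖ x) y ≡ A y
∖-other A {x} {y} y≢x with y ℕ.≟ x
... | yes y≡x = contradiction y≡x y≢x
... | no _    = refl

∖-member : ∀ A {x y} → (A ∖ x) y ≡ true → A y ≡ true × y ≢ x
∖-member A {x} {y} A∖x∋y with y ℕ.≟ x
... | no y≢x = A∖x∋y , y≢x

#-cong : ∀ n {A B} → (∀ {i} → i < n → A i ≡ B i) → #[ A ]< n ≡ #[ B ]< n
#-cong zero    _   = refl
#-cong (suc n) A≡B =
  cong₂ (λ b k → (if b then 1 else 0) ℕ.+ k) (A≡B (ℕ.n<1+n n)) (#-cong n (A≡B ∘ ℕ.m<n⇒m<1+n))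

#≡0⇒∏≡1 : ∀ n {A} → #[ A ]< n ≡ 0 → ∏[ A ]< n ≡ 1ℤ
#≡0⇒∏≡1 zero    _    = refl
#≡0⇒∏≡1 (suc n) {A} #≡0 with A n
... | false = trans (ℤ.*-identityʳ _) (#≡0⇒∏≡1 n #≡0)

#≢0⇒member : ∀ n {A k} → #[ A ]< n ≡ suc k → ∃ λ x → x < n × A x ≡ true
#≢0⇒member (suc n) {A} #≡1+k with A n in An
... | true  = n , ℕ.n<1+n n , An
... | false = let x , x<n , Ax = #≢0⇒member n #≡1+k in x , ℕ.m<n⇒m<1+n x<n , Ax

remove-# : ∀ n {A x} → x < n → A x ≡ true → #[ A ]< n ≡ suc (#[ A ∖ x ]< n)
remove-# (suc n) {A} {x} x<1+n Ax with ℕ.m<1+n⇒m<n∨m≡n x<1+n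
... | inj₂ refl rewrite Ax | ∖-self A x = cong suc (#-cong n (λ i<n → sym (∖-other A (ℕ.<⇒≢ i<n))))
... | inj₁ x<n rewrite ∖-other A (ℕ.>⇒≢ x<n) =
  trans (cong ((if A n then 1 else 0) ℕ.+_) (remove-# n x<n Ax)) (ℕ.+-suc _ _)

remove-∏ : ∀ n {A x} → x < n → A x ≡ true → ∏[ A ]< n ≡ ∏[ A ∖ x ]< n * + x
remove-∏ n {A} {x} x<n Ax = begin
  ∏[ A ]< n                              ≡⟨ ℤ.*-identityʳ _ ⟨
  ∏[ A ]< n * 1ℤ                         ≡⟨ cong (λ b → ∏[ A ]< n * (if b then + x else 1ℤ)) (∖-self A x) ⟨
  ∏[ A ]< n * (if (A ∖ x) x then + x else 1ℤ)
    ≡⟨ Π-update x<n (λ {i} _ i≢x → cong (λ b → if b then + i else 1ℤ) (sym (∖-other A i≢x))) ⟩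
  ∏[ A ∖ x ]< n * (if A x then + x else 1ℤ) ≡⟨ cong (λ b → ∏[ A ∖ x ]< n * (if b then + x else 1ℤ)) Ax ⟩
  ∏[ A ∖ x ]< n * + x                    ∎
  where open ≡-Reasoning

remove-pair-# : ∀ n {A x y} → x < n → y < n → A x ≡ true → (A ∖ x) y ≡ true →
                #[ A ]< n ≡ suc (suc (#[ A ∖ x ∖ y ]< n))
remove-pair-# n x<n y<n Ax A∖x∋y = trans (remove-# n x<n Ax) (cong suc (remove-# n y<n A∖x∋y))

remove-pair-∏ : ∀ n {A x y} → x < n → y < n → A x ≡ true → (A ∖ x) y ≡ true →
                ∏[ A ]< n ≡ ∏[ A ∖ x ∖ y ]< n * (+ y * + x)
remove-pair-∏ n {A} {x} {y} x<n y<n Ax A∖x∋y = begin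
  ∏[ A ]< n                       ≡⟨ remove-∏ n x<n Ax ⟩
  ∏[ A ∖ x ]< n * + x             ≡⟨ cong (_* + x) (remove-∏ n y<n A∖x∋y) ⟩
  ∏[ A ∖ x ∖ y ]< n * + y * + x   ≡⟨ ℤ.*-assoc (∏[ A ∖ x ∖ y ]< n) (+ y) (+ x) ⟩
  ∏[ A ∖ x ∖ y ]< n * (+ y * + x) ∎
  where open ≡-Reasoning

∖∖-member : ∀ A {x y z} → (A ∖ x ∖ y) z ≡ true → A z ≡ true × z ≢ x × z ≢ y
∖∖-member A A∖x∖y∋z = let A∖x∋z , z≢y = ∖-member (A ∖ _) A∖x∖y∋z
                          Az , z≢x = ∖-member A A∖x∋z
                      in Az , z≢x , z≢y

2+n≡2h⇒n≡2[h-1] : ∀ {n} h → suc (suc n) ≡ 2 ℕ.* h → n ≡ 2 ℕ.* ℕ.pred h × h ≡ suc (ℕ.pred h)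
2+n≡2h⇒n≡2[h-1] (suc h) 2+n≡2+2h =
  ℕ.suc-injective (ℕ.suc-injective (trans 2+n≡2+2h (cong suc (ℕ.+-suc h (h ℕ.+ 0))))) , refl

record PairedBy (m n : ℕ) (c : ℤ) (ι : ℕ → ℕ) (A : ℕ → Bool) : Set where
  field
    partner-below : ∀ {x} → x < n → A x ≡ true → ι x < n
    partner-∈     : ∀ {x} → x < n → A x ≡ true → A (ι x) ≡ true
    partner-≢     : ∀ {x} → x < n → A x ≡ true → ι x ≢ x
    partner-inv   : ∀ {x} → x < n → A x ≡ true → ι (ι x) ≡ x
    partner-*     : ∀ {x} → x < n → A x ≡ true → + x * + ι x ≡ c mod m

∏-paired : ∀ {m n c ι} k {A} → #[ A ]< n ≡ 2 ℕ.* k → PairedBy m n c ι A → ∏[ A ]< n ≡ c ^ k mod m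
∏-paired {n = n} zero #≡0 _ = mod-reflexive (#≡0⇒∏≡1 n #≡0)
∏-paired {m} {n} {c} {ι} (suc k) {A} #≡2+2k paired with #≢0⇒member n #≡2+2k
... | x , x<n , Ax = begin
  ∏[ A ]< n                       ≡⟨ remove-pair-∏ n x<n y<n Ax A∖x∋y ⟩
  ∏[ A ∖ x ∖ y ]< n * (+ y * + x) ≈⟨ *-cong-mod (∏-paired k #≡2k paired′) yx≡c ⟩
  c ^ k * c                       ≡⟨ ℤ.*-comm (c ^ k) c ⟩
  c ^ suc k                       ∎
  where
  open ≡-mod-Reasoning m
  open PairedBy paired
  y : ℕ
  y = ι x
  y<n : y < n
  y<n = partner-below x<n Ax
  A∖x∋y : (A ∖ x) y ≡ true
  A∖x∋y = trans (∖-other A (partner-≢ x<n Ax)) (partner-∈ x<n Ax)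
  yx≡c : + y * + x ≡ c mod m
  yx≡c = mod-trans (mod-reflexive (ℤ.*-comm (+ y) (+ x))) (partner-* x<n Ax)
  #≡2k : #[ A ∖ x ∖ y ]< n ≡ 2 ℕ.* k
  #≡2k = proj₁ (2+n≡2h⇒n≡2[h-1] (suc k) (trans (sym (remove-pair-# n x<n y<n Ax A∖x∋y)) #≡2+2k))
  partner∈ : ∀ {z} → z < n → (A ∖ x ∖ y) z ≡ true → (A ∖ x ∖ y) (ι z) ≡ true
  partner∈ {z} z<n A∖x∖y∋z with ∖∖-member A A∖x∖y∋z
  ... | Az , z≢x , z≢y = trans (∖-other (A ∖ x) ιz≢y) (trans (∖-other A ιz≢x) (partner-∈ z<n Az))
    where
    ιz≢x : ι z ≢ x
    ιz≢x ιz≡x = z≢y (trans (sym (partner-inv z<n Az)) (cong ι ιz≡x))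
    ιz≢y : ι z ≢ y
    ιz≢y ιz≡y = z≢x (trans (sym (partner-inv z<n Az)) (trans (cong ι ιz≡y) (partner-inv x<n Ax)))
  paired′ : PairedBy m n c ι (A ∖ x ∖ y)
  paired′ = record
    { partner-below = λ z<n → partner-below z<n ∘ proj₁ ∘ ∖∖-member A
    ; partner-∈     = partner∈
    ; partner-≢     = λ z<n → partner-≢ z<n ∘ proj₁ ∘ ∖∖-member A
    ; partner-inv   = λ z<n → partner-inv z<n ∘ proj₁ ∘ ∖∖-member A
    ; partner-*     = λ z<n → partner-* z<n ∘ proj₁ ∘ ∖∖-member A
    }

isUnit : ℕ → Bool
isUnit zero    = false
isUnit (suc _) = true

#-isUnit : ∀ n → #[ isUnit ]< suc n ≡ n
#-isUnit zero    = refl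
#-isUnit (suc n) = cong suc (#-isUnit n)

isUnit⇒>0 : ∀ {x} → isUnit x ≡ true → 0 < x
isUnit⇒>0 {suc _} _ = s≤s z≤n

>0⇒isUnit : ∀ {x} → 0 < x → isUnit x ≡ true
>0⇒isUnit {suc _} _ = refl

module Euler {p h : ℕ} .{{_ : NonZero p}} (p-prime : Prime p) (p≡1+2h : p ≡ suc (2 ℕ.* h)) where

  [p-1]! : ℤ
  [p-1]! = ∏[ isUnit ]< p

  #units : #[ isUnit ]< p ≡ 2 ℕ.* h
  #units = subst (λ n → #[ isUnit ]< n ≡ 2 ℕ.* h) (sym p≡1+2h) (#-isUnit (2 ℕ.* h))

  module Partner (c : ℤ) (c≢0 : ¬ (c ≡ 0ℤ mod p)) where

    partner : ℕ → ℕ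
    partner x = (inverse p x * c) %ℕ p

    partner<p : ∀ x → partner x < p
    partner<p x = %ℕ<m (inverse p x * c)

    partner-* : ∀ {x} → 0 < x → x < p → + x * + partner x ≡ c mod p
    partner-* {x} 0<x x<p = begin
      + x * + partner x         ≈⟨ *-congˡ-mod (+ x) (mod-sym (a≡a%ℕn-mod (inverse p x * c))) ⟩
      + x * (inverse p x * c)   ≡⟨ ℤ.*-assoc (+ x) (inverse p x) c ⟨
      + x * inverse p x * c     ≈⟨ *-congʳ-mod c (inverse-correct p-prime 0<x x<p) ⟩
      1ℤ * c                    ≡⟨ ℤ.*-identityˡ c ⟩
      c                         ∎
      where open ≡-mod-Reasoning p

    partner-unique : ∀ {x y} → 0 < x → x < p → y < p → + x * + y ≡ c mod p → y ≡ partner x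
    partner-unique {x} 0<x x<p y<p xy≡c = residue-unique y<p (partner<p x)
      (*-cancelˡ-mod p-prime (nonzero-residue 0<x x<p) (mod-trans xy≡c (mod-sym (partner-* 0<x x<p))))

    partner>0 : ∀ {x} → 0 < x → x < p → 0 < partner x
    partner>0 {x} 0<x x<p = ℕ.n≢0⇒n>0 λ partner≡0 →
      c≢0 (mod-trans (mod-sym (partner-* 0<x x<p))
                     (mod-reflexive (trans (cong (λ y → + x * + y) partner≡0) (ℤ.*-zeroʳ (+ x)))))

    partner-involutive : ∀ {x} → 0 < x → x < p → partner (partner x) ≡ x
    partner-involutive {x} 0<x x<p = sym (partner-unique (partner>0 0<x x<p) (partner<p x) x<p
      (mod-trans (mod-reflexive (ℤ.*-comm (+ partner x) (+ x))) (partner-* 0<x x<p)))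

    fixed⇒square : ∀ {x} → 0 < x → x < p → partner x ≡ x → + x * + x ≡ c mod p
    fixed⇒square {x} 0<x x<p partner≡x = subst (λ y → + x * + y ≡ c mod p) partner≡x (partner-* 0<x x<p)

    pairedBy-partner : ∀ {A} → (∀ {x} → A x ≡ true → 0 < x) →
                       (∀ {x} → x < p → A x ≡ true → A (partner x) ≡ true) →
                       (∀ {x} → x < p → A x ≡ true → ¬ (+ x * + x ≡ c mod p)) →
                       PairedBy p p c partner A
    pairedBy-partner A>0 closed non-square = record
      { partner-below = λ {x} _ _ → partner<p x
      ; partner-∈     = closed
      ; partner-≢     = λ x<p Ax → non-square x<p Ax ∘ fixed⇒square (A>0 Ax) x<p
      ; partner-inv   = λ x<p Ax → partner-involutive (A>0 Ax) x<p
      ; partner-*     = λ x<p Ax → partner-* (A>0 Ax) x<p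
      }

  nonresidue⇒[p-1]!≡c^h : ∀ {c} → ¬ (c ≡ 0ℤ mod p) → (∀ {x} → x < p → ¬ (+ x * + x ≡ c mod p)) →
                              [p-1]! ≡ c ^ h mod p
  nonresidue⇒[p-1]!≡c^h {c} c≢0 non-square = ∏-paired h #units
    (pairedBy-partner isUnit⇒>0 (λ x<p Ax → >0⇒isUnit (partner>0 (isUnit⇒>0 Ax) x<p)) (λ x<p _ → non-square x<p))
    where open Partner c c≢0

  module SquareRoot {c : ℤ} (c≢0 : ¬ (c ≡ 0ℤ mod p)) {y : ℕ} (y<p : y < p) (yy≡c : + y * + y ≡ c mod p) where
    open Partner c c≢0

    y>0 : 0 < y
    y>0 = ℕ.n≢0⇒n>0 λ { refl → c≢0 (mod-sym yy≡c) }

    y′ : ℕ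
    y′ = p ℕ.∸ y

    y′<p : y′ < p
    y′<p = ℕ.∸-monoʳ-< y>0 (ℕ.<⇒≤ y<p)

    y′≡-y : + y′ ≡ - + y mod p
    y′≡-y = m∸n≡-n-mod (ℕ.<⇒≤ y<p)

    y′≢y : y′ ≢ y
    y′≢y y′≡y = ℕ.even≢odd y h (begin
      2 ℕ.* y         ≡⟨ cong (y ℕ.+_) (ℕ.+-identityʳ y) ⟩
      y ℕ.+ y         ≡⟨ cong (ℕ._+ y) y′≡y ⟨
      y′ ℕ.+ y        ≡⟨ ℕ.m∸n+n≡m (ℕ.<⇒≤ y<p) ⟩
      p               ≡⟨ p≡1+2h ⟩
      suc (2 ℕ.* h)   ∎)
      where open ≡-Reasoning

    y′y′≡c : + y′ * + y′ ≡ c mod p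
    y′y′≡c = mod-trans (*-cong-mod y′≡-y y′≡-y) (mod-trans (mod-reflexive (neg-square (+ y))) yy≡c)
      where
      neg-square : ∀ y → - y * - y ≡ y * y
      neg-square = solve-∀

    partner-y : partner y ≡ y
    partner-y = sym (partner-unique y>0 y<p y<p yy≡c)

    partner-y′ : partner y′ ≡ y′
    partner-y′ = sym (partner-unique (ℕ.m<n⇒0<n∸m y<p) y′<p y′<p y′y′≡c)

    y′y≡-c : + y′ * + y ≡ - c mod p
    y′y≡-c = begin
      + y′ * + y      ≈⟨ *-congʳ-mod (+ y) y′≡-y ⟩
      - + y * + y     ≡⟨ ℤ.neg-distribˡ-* (+ y) (+ y) ⟨
      - (+ y * + y)   ≈⟨ neg-cong-mod yy≡c ⟩
      - c             ∎
      where open ≡-mod-Reasoning p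

    -- y and p − y are the only fixed points of the partner map; the other units pair off.
    others : ℕ → Bool
    others = isUnit ∖ y ∖ y′

    isUnit∖y∋y′ : (isUnit ∖ y) y′ ≡ true
    isUnit∖y∋y′ = trans (∖-other isUnit y′≢y) (>0⇒isUnit (ℕ.m<n⇒0<n∸m y<p))

    others-paired : PairedBy p p c partner others
    others-paired = pairedBy-partner (isUnit⇒>0 ∘ proj₁ ∘ ∖∖-member isUnit) closed non-square
      where
      closed : ∀ {z} → z < p → others z ≡ true → others (partner z) ≡ true
      closed {z} z<p others∋z = partner∈ (∖∖-member isUnit others∋z)
        where
        partner-avoids : ∀ {w} → 0 < z → partner w ≡ w → z ≢ w → partner z ≢ w
        partner-avoids z>0 ιw≡w z≢w ιz≡w =
          z≢w (trans (sym (partner-involutive z>0 z<p)) (trans (cong partner ιz≡w) ιw≡w))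
        partner∈ : isUnit z ≡ true × z ≢ y × z ≢ y′ → others (partner z) ≡ true
        partner∈ (unit-z , z≢y , z≢y′) =
          trans (∖-other (isUnit ∖ y) (partner-avoids z>0 partner-y′ z≢y′))
                (trans (∖-other isUnit (partner-avoids z>0 partner-y z≢y)) (>0⇒isUnit (partner>0 z>0 z<p)))
          where
          z>0 : 0 < z
          z>0 = isUnit⇒>0 unit-z

      non-square : ∀ {z} → z < p → others z ≡ true → ¬ (+ z * + z ≡ c mod p)
      non-square {z} z<p others∋z zz≡c =
        excluded (∖∖-member isUnit others∋z) (square-roots-mod p-prime (mod-trans zz≡c (mod-sym yy≡c)))
        where
        excluded : isUnit z ≡ true × z ≢ y × z ≢ y′ → + z ≡ + y mod p ⊎ + z ≡ - + y mod p → ⊥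
        excluded (_ , z≢y , _)  (inj₁ z≡y)  = z≢y (residue-unique z<p y<p z≡y)
        excluded (_ , _ , z≢y′) (inj₂ z≡-y) = z≢y′ (residue-unique z<p y′<p (mod-trans z≡-y (mod-sym y′≡-y)))

    residue⇒[p-1]!≡-c^h : [p-1]! ≡ - (c ^ h) mod p
    residue⇒[p-1]!≡-c^h = begin
      ∏[ isUnit ]< p                 ≡⟨ remove-pair-∏ p y<p y′<p (>0⇒isUnit y>0) isUnit∖y∋y′ ⟩
      ∏[ others ]< p * (+ y′ * + y)  ≈⟨ *-cong-mod (∏-paired (ℕ.pred h) (proj₁ halves) others-paired) y′y≡-c ⟩
      c ^ ℕ.pred h * - c             ≡⟨ rearrange (c ^ ℕ.pred h) c ⟩
      - (c ^ suc (ℕ.pred h))         ≡⟨ cong (λ k → - (c ^ k)) (proj₂ halves) ⟨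
      - (c ^ h)                      ∎
      where
      open ≡-mod-Reasoning p
      halves : #[ others ]< p ≡ 2 ℕ.* ℕ.pred h × h ≡ suc (ℕ.pred h)
      halves = 2+n≡2h⇒n≡2[h-1] h (trans (sym (remove-pair-# p y<p y′<p (>0⇒isUnit y>0) isUnit∖y∋y′)) #units)
      rearrange : ∀ a c → a * - c ≡ - (c * a)
      rearrange = solve-∀

  1<p : 1 < p
  1<p = ℕ.nonTrivial⇒n>1 p {{prime⇒nonTrivial p-prime}}

  wilson : [p-1]! ≡ -1ℤ mod p
  wilson = mod-trans (SquareRoot.residue⇒[p-1]!≡-c^h (nonzero-residue (s≤s z≤n) 1<p) 1<p mod-refl)
                     (mod-reflexive (cong -_ (ℤ.^-zeroˡ h)))

  euler-nonresidue : ∀ {c} → ¬ (c ≡ 0ℤ mod p) → (∀ {x} → x < p → ¬ (+ x * + x ≡ c mod p)) →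
                     c ^ h ≡ -1ℤ mod p
  euler-nonresidue c≢0 non-square = mod-trans (mod-sym (nonresidue⇒[p-1]!≡c^h c≢0 non-square)) wilson

  euler-residue : ∀ {c y} → ¬ (c ≡ 0ℤ mod p) → y < p → + y * + y ≡ c mod p → c ^ h ≡ 1ℤ mod p
  euler-residue {c} c≢0 y<p yy≡c = begin
    c ^ h         ≡⟨ ℤ.neg-involutive (c ^ h) ⟨
    - - (c ^ h)   ≈⟨ neg-cong-mod (mod-trans (mod-sym (SquareRoot.residue⇒[p-1]!≡-c^h c≢0 y<p yy≡c)) wilson) ⟩
    1ℤ            ∎
    where open ≡-mod-Reasoning p

module _ {p : ℕ} .{{_ : NonZero p}} where

  isSquareMod-sound : ∀ {a} → T (isSquareMod p a) → ∃ λ x → x < p × + x * + x ≡ a mod p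
  isSquareMod-sound {a} square with find (any⁻ _ (upTo p) square)
  ... | x , x∈upTo , xx%p≡a%p = x , ∈-upTo⁻ x∈upTo , (begin
    + x * + x               ≡⟨ ℤ.pos-* x x ⟨
    + (x ℕ.* x)             ≈⟨ a≡a%ℕn-mod (+ (x ℕ.* x)) ⟩
    + ((x ℕ.* x) ℕ.% p)     ≡⟨ cong +_ (ℕ.≡ᵇ⇒≡ _ _ xx%p≡a%p) ⟩
    + (a %ℕ p)              ≈⟨ a≡a%ℕn-mod a ⟨
    a                       ∎)
    where open ≡-mod-Reasoning p

  isSquareMod-complete : ∀ {a x} → x < p → + x * + x ≡ a mod p → T (isSquareMod p a)
  isSquareMod-complete {a} {x} x<p xx≡a = any⁺ _ (lose (∈-upTo⁺ x<p) (ℕ.≡⇒≡ᵇ _ _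
    (residue-unique (%ℕ<m (+ (x ℕ.* x))) (%ℕ<m a) (begin
      + ((x ℕ.* x) ℕ.% p)   ≈⟨ a≡a%ℕn-mod (+ (x ℕ.* x)) ⟨
      + (x ℕ.* x)           ≡⟨ ℤ.pos-* x x ⟩
      + x * + x             ≈⟨ xx≡a ⟩
      a                     ≈⟨ a≡a%ℕn-mod a ⟩
      + (a %ℕ p)            ∎))))
    where open ≡-mod-Reasoning p

  legendre-unit : ∀ {a} → ¬ (a ≡ 0ℤ mod p) → legendre p a ≡ (if isSquareMod p a then 1ℤ else -1ℤ)
  legendre-unit {a} a≢0 with a %ℕ p in a%p≡r
  ... | zero  = contradiction (mod-trans (a≡a%ℕn-mod a) (mod-reflexive (cong +_ a%p≡r))) a≢0
  ... | suc _ = refl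

  legendre-±1 : ∀ {a} → ¬ (a ≡ 0ℤ mod p) → legendre p a ≡ 1ℤ ⊎ legendre p a ≡ -1ℤ
  legendre-±1 {a} a≢0 rewrite legendre-unit a≢0 with isSquareMod p a
  ... | true  = inj₁ refl
  ... | false = inj₂ refl

euler-criterion : ∀ {p h} .{{_ : NonZero p}} → Prime p → p ≡ suc (2 ℕ.* h) →
                  ∀ {a} → ¬ (a ≡ 0ℤ mod p) → legendre p a ≡ a ^ h mod p
euler-criterion {p} {h} p-prime p≡1+2h {a} a≢0 rewrite legendre-unit a≢0 with isSquareMod p a in square
... | true  = let x , x<p , xx≡a = isSquareMod-sound (subst T (sym square) _) in mod-sym (euler-residue a≢0 x<p xx≡a)
  where open Euler {p} {h} p-prime p≡1+2h
... | false = mod-sym (euler-nonresidue a≢0 λ x<p xx≡a → subst T square (isSquareMod-complete x<p xx≡a))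
  where open Euler {p} {h} p-prime p≡1+2h

-- Hermite's identity and the parity of S

pos-∸ : ∀ {m n} → n ≤ m → + (m ℕ.∸ n) ≡ + m - + n
pos-∸ {m} {n} n≤m = sym (trans (ℤ.m-n≡m⊖n m n) (ℤ.⊖-≥ n≤m))

module _ {p : ℕ} .{{_ : NonZero p}} where

  hermiteℕ : ∀ r → Σ[< p ] (λ ν → + ((r ℕ.+ ν) ℕ./ p)) ≡ + r
  hermiteℕ zero =
    trans (Σ-cong p (λ ν<p → cong +_ (ℕ.m<n⇒m/n≡0 ν<p))) (trans (Σ-const p 0ℤ) (ℤ.*-zeroʳ (+ p)))
  hermiteℕ (suc r) = +-cancelˡ (f 0) _ _ (begin
    f 0 + Σ[< p ] (λ ν → + ((suc r ℕ.+ ν) ℕ./ p))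
      ≡⟨ cong (λ k → f 0 + k) (Σ-cong p (λ {ν} _ → cong (λ k → + (k ℕ./ p)) (ℕ.+-suc r ν))) ⟨
    f 0 + Σ[< p ] (f ∘ suc)
      ≡⟨ Σ-shift p f ⟨
    Σ[< p ] f + f p
      ≡⟨ cong₂ _+_ (hermiteℕ r) (cong +_ (ℕ.m/n≡1+[m∸n]/n (ℕ.m≤n+m p r))) ⟩
    + r + + suc ((r ℕ.+ p ℕ.∸ p) ℕ./ p)
      ≡⟨ cong (λ k → + r + + suc (k ℕ./ p)) (trans (ℕ.m+n∸n≡m r p) (sym (ℕ.+-identityʳ r))) ⟩
    + r + (1ℤ + f 0)
      ≡⟨ rearrange (+ r) (f 0) ⟩
    f 0 + + suc r ∎)
    where
    open ≡-Reasoning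
    f : ℕ → ℤ
    f ν = + ((r ℕ.+ ν) ℕ./ p)
    rearrange : ∀ r q → r + (1ℤ + q) ≡ q + (1ℤ + r)
    rearrange = solve-∀

  /ℕ-shift : ∀ x ν → (x + + ν) /ℕ p ≡ x /ℕ p + + ((x %ℕ p ℕ.+ ν) ℕ./ p)
  /ℕ-shift x ν = /ℕ-unique (x /ℕ p + + s) (ℕ.m%n<n (r ℕ.+ ν) p) (begin
    x + + ν
      ≡⟨ cong (_+ + ν) (ℤ.a≡a%ℕn+[a/ℕn]*n x p) ⟩
    + r + x /ℕ p * + p + + ν
      ≡⟨ rearrange (+ r) (x /ℕ p * + p) (+ ν) ⟩
    (+ r + + ν) + x /ℕ p * + p
      ≡⟨ cong (_+ x /ℕ p * + p) (ℤ.pos-+ r ν) ⟨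
    + (r ℕ.+ ν) + x /ℕ p * + p
      ≡⟨ cong (λ k → + k + x /ℕ p * + p) (ℕ.m≡m%n+[m/n]*n (r ℕ.+ ν) p) ⟩
    + (r′ ℕ.+ s ℕ.* p) + x /ℕ p * + p
      ≡⟨ cong (_+ x /ℕ p * + p) (trans (ℤ.pos-+ r′ (s ℕ.* p)) (cong (λ k → + r′ + k) (ℤ.pos-* s p))) ⟩
    + r′ + + s * + p + x /ℕ p * + p
      ≡⟨ collect (+ r′) (+ s) (x /ℕ p) (+ p) ⟩
    + r′ + (x /ℕ p + + s) * + p ∎)
    where
    open ≡-Reasoning
    r s r′ : ℕ
    r = x %ℕ p
    s = (r ℕ.+ ν) ℕ./ p
    r′ = (r ℕ.+ ν) ℕ.% p
    rearrange : ∀ r k ν → r + k + ν ≡ (r + ν) + k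
    rearrange = solve-∀
    collect : ∀ r s q p → r + s * p + q * p ≡ r + (q + s) * p
    collect = solve-∀

  hermite : ∀ x → Σ[< p ] (λ ν → (x + + ν) /ℕ p) ≡ x
  hermite x = begin
    Σ[< p ] (λ ν → (x + + ν) /ℕ p)
      ≡⟨ Σ-cong p (λ {ν} _ → /ℕ-shift x ν) ⟩
    Σ[< p ] (λ ν → x /ℕ p + + ((x %ℕ p ℕ.+ ν) ℕ./ p))
      ≡⟨ Σ-distrib p _ _ ⟩
    Σ[< p ] (λ _ → x /ℕ p) + Σ[< p ] (λ ν → + ((x %ℕ p ℕ.+ ν) ℕ./ p))
      ≡⟨ cong₂ _+_ (Σ-const p (x /ℕ p)) (hermiteℕ (x %ℕ p)) ⟩
    + p * (x /ℕ p) + + (x %ℕ p)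
      ≡⟨ ℤ.+-comm (+ p * (x /ℕ p)) (+ (x %ℕ p)) ⟩
    + (x %ℕ p) + + p * (x /ℕ p)
      ≡⟨ cong (λ k → + (x %ℕ p) + k) (ℤ.*-comm (+ p) (x /ℕ p)) ⟩
    + (x %ℕ p) + x /ℕ p * + p
      ≡⟨ ℤ.a≡a%ℕn+[a/ℕn]*n x p ⟨
    x ∎
    where open ≡-Reasoning

module OddModulus {p h : ℕ} .{{_ : NonZero p}} (p≡1+2h : p ≡ suc (2 ℕ.* h)) where

  +p≡1+2h : + p ≡ 1ℤ + + 2 * + h
  +p≡1+2h = trans (cong +_ p≡1+2h) (cong (λ k → 1ℤ + k) (ℤ.pos-* 2 h))

  isUpper : ℕ → Bool
  isUpper r = h ℕ.<ᵇ r

  fold : ℕ → ℕ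
  fold r = if isUpper r then p ℕ.∸ r else r

  fold-range : ∀ {r} → 0 < r → r < p → 0 < fold r × fold r ≤ h
  fold-range {r} 0<r r<p with isUpper r | ℕ.<ᵇ-reflects-< h r
  ... | true  | ofʸ h<r = ℕ.m<n⇒0<n∸m r<p , ℕ.≤-trans (ℕ.∸-monoʳ-≤ p h<r) (ℕ.≤-reflexive p∸[1+h]≡h)
    where
    p∸[1+h]≡h : p ℕ.∸ suc h ≡ h
    p∸[1+h]≡h = trans (cong (ℕ._∸ suc h) p≡1+2h) (trans (ℕ.m+n∸m≡n h (h ℕ.+ 0)) (ℕ.+-identityʳ h))
  ... | false | ofⁿ h≮r = 0<r , ℕ.≮⇒≥ h≮r

  fold-sign : ∀ {r} → r < p → + r ≡ sign (isUpper r) * + fold r mod p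
  fold-sign {r} r<p with isUpper r
  ... | true  = mod-sym (begin
    -1ℤ * + (p ℕ.∸ r) ≈⟨ *-congˡ-mod -1ℤ (m∸n≡-n-mod (ℕ.<⇒≤ r<p)) ⟩
    -1ℤ * - + r       ≡⟨ neg-neg (+ r) ⟩
    + r               ∎)
    where
    open ≡-mod-Reasoning p
    neg-neg : ∀ x → -1ℤ * - x ≡ x
    neg-neg = solve-∀
  ... | false = mod-reflexive (sym (ℤ.*-identityˡ (+ r)))

  fold-parity : ∀ {r} → r < p → + r ≡ + fold r + indicator (isUpper r) mod 2
  fold-parity {r} r<p with isUpper r
  ... | true  = ∣⇒≡-mod (divides (+ r - 1ℤ - + h) (begin
    + r - (+ (p ℕ.∸ r) + 1ℤ)               ≡⟨ cong (λ k → + r - (k + 1ℤ)) (pos-∸ (ℕ.<⇒≤ r<p)) ⟩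
    + r - ((+ p - + r) + 1ℤ)               ≡⟨ cong (λ k → + r - ((k - + r) + 1ℤ)) +p≡1+2h ⟩
    + r - (((1ℤ + + 2 * + h) - + r) + 1ℤ)  ≡⟨ identity (+ r) (+ h) ⟩
    (+ r - 1ℤ - + h) * + 2                 ∎))
    where
    open ≡-Reasoning
    identity : ∀ r h → r - (((1ℤ + + 2 * h) - r) + 1ℤ) ≡ (r - 1ℤ - h) * + 2
    identity = solve-∀
  ... | false = mod-reflexive (sym (ℤ.+-identityʳ (+ r)))

  opposite-pair-parity : ∀ {μ r} → μ ≤ p → r ≤ p →
                         + μ * + r + + (p ℕ.∸ μ) * + (p ℕ.∸ r) ≡ 1ℤ + (+ μ + + r) mod 2
  opposite-pair-parity {μ} {r} μ≤p r≤p = ∣⇒≡-mod (divides k (begin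
    + μ * + r + + (p ℕ.∸ μ) * + (p ℕ.∸ r) - (1ℤ + (+ μ + + r))
      ≡⟨ cong₂ (λ u v → + μ * + r + u * v - (1ℤ + (+ μ + + r))) (pos-∸ μ≤p) (pos-∸ r≤p) ⟩
    + μ * + r + (+ p - + μ) * (+ p - + r) - (1ℤ + (+ μ + + r))
      ≡⟨ cong (λ P → + μ * + r + (P - + μ) * (P - + r) - (1ℤ + (+ μ + + r))) +p≡1+2h ⟩
    + μ * + r + ((1ℤ + + 2 * + h) - + μ) * ((1ℤ + + 2 * + h) - + r) - (1ℤ + (+ μ + + r))
      ≡⟨ identity (+ μ) (+ r) (+ h) ⟩
    k * + 2 ∎))
    where
    open ≡-Reasoning
    k : ℤ
    k = + μ * + r - + μ - + r - + h * (+ μ + + r) + + 2 * + h + + 2 * + h * + h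
    identity : ∀ μ r h → μ * r + ((1ℤ + + 2 * h) - μ) * ((1ℤ + + 2 * h) - r) - (1ℤ + (μ + r)) ≡
                         (μ * r - μ - r - h * (μ + r) + + 2 * h + + 2 * h * h) * + 2
    identity = solve-∀

  Σ-opposite-pairs : ∀ G → Σ[< p ] G ≡ G 0 + Σ[< h ] (λ j → G (suc j) + G (p ℕ.∸ suc j))
  Σ-opposite-pairs G = begin
    Σ[< p ] G
      ≡⟨ cong (λ n → Σ[< n ] G) p≡1+2h ⟩
    Σ[< suc (2 ℕ.* h) ] G
      ≡⟨ Σ-shift (2 ℕ.* h) G ⟩
    G 0 + Σ[< 2 ℕ.* h ] (G ∘ suc)
      ≡⟨ cong (λ n → G 0 + Σ[< h ℕ.+ n ] (G ∘ suc)) (ℕ.+-identityʳ h) ⟩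
    G 0 + Σ[< h ℕ.+ h ] (G ∘ suc)
      ≡⟨ cong (λ k → G 0 + k) (Σ-split h h (G ∘ suc)) ⟩
    G 0 + (Σ[< h ] (G ∘ suc) + Σ[< h ] (λ j → G (suc (h ℕ.+ j))))
      ≡⟨ cong (λ s → G 0 + (Σ[< h ] (G ∘ suc) + s)) reversed ⟨
    G 0 + (Σ[< h ] (G ∘ suc) + Σ[< h ] (λ j → G (p ℕ.∸ suc j)))
      ≡⟨ cong (λ k → G 0 + k) (Σ-distrib h _ _) ⟨
    G 0 + Σ[< h ] (λ j → G (suc j) + G (p ℕ.∸ suc j)) ∎
    where
    open ≡-Reasoning
    reverse : ℕ → ℕ
    reverse j = h ℕ.∸ suc j
    reverse-perm : IsPermutation h reverse
    reverse-perm = record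
      { maps-below      = λ j<h → ℕ.∸-monoʳ-< (s≤s z≤n) j<h
      ; injective-below = λ i<h j<h → ℕ.suc-injective ∘ ℕ.∸-cancelˡ-≡ i<h j<h
      }
    upper-half : ∀ {j} → j < h → suc (h ℕ.+ reverse j) ≡ p ℕ.∸ suc j
    upper-half {j} j<h = begin
      suc (h ℕ.+ (h ℕ.∸ suc j))   ≡⟨ ℕ.+-suc h (h ℕ.∸ suc j) ⟨
      h ℕ.+ suc (h ℕ.∸ suc j)     ≡⟨ cong (h ℕ.+_) (ℕ.+-∸-assoc 1 j<h) ⟨
      h ℕ.+ (h ℕ.∸ j)             ≡⟨ ℕ.+-∸-assoc h (ℕ.<⇒≤ j<h) ⟨
      (h ℕ.+ h) ℕ.∸ j             ≡⟨ cong (λ n → suc (h ℕ.+ n) ℕ.∸ suc j) (ℕ.+-identityʳ h) ⟨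
      suc (2 ℕ.* h) ℕ.∸ suc j     ≡⟨ cong (ℕ._∸ suc j) p≡1+2h ⟨
      p ℕ.∸ suc j                 ∎
    reversed : Σ[< h ] (λ j → G (p ℕ.∸ suc j)) ≡ Σ[< h ] (λ j → G (suc (h ℕ.+ j)))
    reversed = trans (Σ-cong h (λ j<h → cong G (sym (upper-half j<h))))
                     (Σ-permute h reverse-perm (λ j → G (suc (h ℕ.+ j))))

  legendre-0 : legendre p 0ℤ ≡ 0ℤ
  legendre-0 rewrite ℕ.m<n⇒m%n≡m (ℕ.>-nonZero⁻¹ p) = refl

  legendre-odd : ∀ {ν} → 0 < ν → ν < p → legendre p (+ ν) ≡ 1ℤ mod 2
  legendre-odd {suc ν} _ ν<p with isSquareMod p (+ suc ν)
  ... | true  rewrite ℕ.m<n⇒m%n≡m ν<p = mod-refl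
  ... | false rewrite ℕ.m<n⇒m%n≡m ν<p = ∣⇒≡-mod (divides -1ℤ refl)

  legendre-sum-parity : ∀ x → Σ[< p ] (λ ν → legendre p (+ ν) * ((x + + ν) /ℕ p)) ≡ + (x %ℕ p) mod 2
  legendre-sum-parity x = begin
    Σ[< p ] (λ ν → χ ν * D ν)
      ≡⟨ cong (λ n → Σ[< n ] (λ ν → χ ν * D ν)) p≡1+2h ⟩
    Σ[< suc (2 ℕ.* h) ] (λ ν → χ ν * D ν)
      ≡⟨ Σ-shift (2 ℕ.* h) _ ⟩
    χ 0 * D 0 + Σ[< 2 ℕ.* h ] (λ j → χ (suc j) * D (suc j))
      ≈⟨ +-cong-mod (mod-reflexive (cong (_* D 0) legendre-0))
                    (Σ-cong-mod (2 ℕ.* h) (λ j<2h → *-congʳ-mod _ (χ-odd j<2h))) ⟩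
    0ℤ * D 0 + Σ[< 2 ℕ.* h ] (λ j → 1ℤ * D (suc j))
      ≡⟨ ℤ.+-identityˡ _ ⟩
    Σ[< 2 ℕ.* h ] (λ j → 1ℤ * D (suc j))
      ≡⟨ Σ-cong (2 ℕ.* h) (λ _ → ℤ.*-identityˡ _) ⟩
    Σ[< 2 ℕ.* h ] (D ∘ suc)
      ≡⟨ tail-sum ⟩
    x - x /ℕ p
      ≈⟨ ∣⇒≡-mod (divides (x /ℕ p * + h) x-q≡r) ⟩
    + (x %ℕ p) ∎
    where
    open ≡-mod-Reasoning 2
    χ D : ℕ → ℤ
    χ ν = legendre p (+ ν)
    D ν = (x + + ν) /ℕ p
    χ-odd : ∀ {j} → j < 2 ℕ.* h → χ (suc j) ≡ 1ℤ mod 2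
    χ-odd j<2h = legendre-odd (s≤s z≤n) (subst (_ <_) (sym p≡1+2h) (s≤s j<2h))
    tail-sum : Σ[< 2 ℕ.* h ] (D ∘ suc) ≡ x - x /ℕ p
    tail-sum = trans (cancel (D 0) _) (cong₂ _-_ (trans (sym split) (hermite x)) (cong (_/ℕ p) (ℤ.+-identityʳ x)))
      where
      cancel : ∀ d t → t ≡ (d + t) - d
      cancel = solve-∀
      split : Σ[< p ] D ≡ D 0 + Σ[< 2 ℕ.* h ] (D ∘ suc)
      split = trans (cong (λ n → Σ[< n ] D) p≡1+2h) (Σ-shift (2 ℕ.* h) D)
    x-q≡r : x - x /ℕ p - + (x %ℕ p) ≡ x /ℕ p * + h * + 2
    x-q≡r = trans (cong (λ y → y - x /ℕ p - + (x %ℕ p)) (ℤ.a≡a%ℕn+[a/ℕn]*n x p))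
                  (trans (cong (λ P → (+ (x %ℕ p) + x /ℕ p * P) - x /ℕ p - + (x %ℕ p)) +p≡1+2h)
                         (identity (+ (x %ℕ p)) (x /ℕ p) (+ h)))
      where
      identity : ∀ r q h → (r + q * (1ℤ + + 2 * h)) - q - r ≡ q * h * + 2
      identity = solve-∀

  S-parity : ∀ a → S p a 0ℤ ≡ Σ[< p ] (λ μ → + μ * + ((a * + μ) %ℕ p)) mod 2
  S-parity a = Σ-cong-mod p (λ {μ} _ → begin
    Σ[< p ] (λ ν → + μ * legendre p (+ ν) * ((a * + μ + a * 0ℤ + + ν) /ℕ p))
      ≡⟨ Σ-cong p (λ {ν} _ → trans (ℤ.*-assoc (+ μ) _ _)
                     (cong (λ y → + μ * (legendre p (+ ν) * ((y + + ν) /ℕ p))) (drop-zero μ))) ⟩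
    Σ[< p ] (λ ν → + μ * (legendre p (+ ν) * ((a * + μ + + ν) /ℕ p)))
      ≡⟨ Σ-*ˡ p (+ μ) _ ⟩
    + μ * Σ[< p ] (λ ν → legendre p (+ ν) * ((a * + μ + + ν) /ℕ p))
      ≈⟨ *-congˡ-mod (+ μ) (legendre-sum-parity (a * + μ)) ⟩
    + μ * + ((a * + μ) %ℕ p) ∎)
    where
    open ≡-mod-Reasoning 2
    drop-zero : ∀ μ → a * + μ + a * 0ℤ ≡ a * + μ
    drop-zero μ = trans (cong (λ k → a * + μ + k) (ℤ.*-zeroʳ a)) (ℤ.+-identityʳ (a * + μ))

-- Gauss's lemma

module Gauss {p h : ℕ} .{{_ : NonZero p}} (p-prime : Prime p) (p≡1+2h : p ≡ suc (2 ℕ.* h))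
             {a : ℤ} (a≢0 : ¬ (a ≡ 0ℤ mod p)) where

  open OddModulus {p} {h} p≡1+2h

  residue : ℕ → ℕ
  residue μ = (a * + μ) %ℕ p

  residue≡ : ∀ μ → + residue μ ≡ a * + μ mod p
  residue≡ μ = mod-sym (a≡a%ℕn-mod (a * + μ))

  residue<p : ∀ μ → residue μ < p
  residue<p μ = %ℕ<m (a * + μ)

  residue>0 : ∀ {μ} → 0 < μ → μ < p → 0 < residue μ
  residue>0 {μ} 0<μ μ<p = ℕ.n≢0⇒n>0 λ r≡0 →
    Sum.[ a≢0 , nonzero-residue 0<μ μ<p ]
      (euclid-mod p-prime (mod-trans (mod-sym (residue≡ μ)) (mod-reflexive (cong +_ r≡0))))

  residue-opposite : ∀ {μ} → 0 < μ → μ < p → residue (p ℕ.∸ μ) ≡ p ℕ.∸ residue μ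
  residue-opposite {μ} 0<μ μ<p =
    residue-unique (residue<p (p ℕ.∸ μ)) (ℕ.∸-monoʳ-< (residue>0 0<μ μ<p) (ℕ.<⇒≤ (residue<p μ))) (begin
    + residue (p ℕ.∸ μ)
      ≈⟨ residue≡ (p ℕ.∸ μ) ⟩
    a * + (p ℕ.∸ μ)
      ≈⟨ *-congˡ-mod a (m∸n≡-n-mod (ℕ.<⇒≤ μ<p)) ⟩
    a * - + μ
      ≡⟨ ℤ.neg-distribʳ-* a (+ μ) ⟨
    - (a * + μ)
      ≈⟨ neg-cong-mod (residue≡ μ) ⟨
    - + residue μ
      ≈⟨ m∸n≡-n-mod (ℕ.<⇒≤ (residue<p μ)) ⟨
    + (p ℕ.∸ residue μ) ∎)
    where open ≡-mod-Reasoning p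

  1+j<p : ∀ {j} → j < h → suc j < p
  1+j<p j<h = subst (_ <_) (sym p≡1+2h) (s≤s (ℕ.≤-trans j<h (ℕ.m≤m+n h (h ℕ.+ 0))))

  no-opposite : ∀ {i j} → i < h → j < h → suc i ≢ p ℕ.∸ suc j
  no-opposite {i} {j} i<h j<h 1+i≡p-1-j = ℕ.<⇒≢ sum<p sum≡p
    where
    sum≡p : suc i ℕ.+ suc j ≡ p
    sum≡p = trans (cong (ℕ._+ suc j) 1+i≡p-1-j) (ℕ.m∸n+n≡m (ℕ.<⇒≤ (1+j<p j<h)))
    sum<p : suc i ℕ.+ suc j < p
    sum<p = subst (_ <_) (sym p≡1+2h)
      (s≤s (ℕ.≤-trans (ℕ.+-mono-≤ i<h j<h) (ℕ.≤-reflexive (cong (h ℕ.+_) (sym (ℕ.+-identityʳ h))))))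

  -- Indexed from 0: t j and upper j are t_μ and [ρ_μ > h] for μ = j + 1.
  upper : ℕ → Bool
  upper j = isUpper (residue (suc j))

  t : ℕ → ℕ
  t j = fold (residue (suc j))

  t-range : ∀ {j} → j < h → 0 < t j × t j ≤ h
  t-range j<h = fold-range (residue>0 (s≤s z≤n) (1+j<p j<h)) (residue<p _)

  a[1+j]≡±t : ∀ {j} → j < h → a * + suc j ≡ sign (upper j) * + t j mod p
  a[1+j]≡±t {j} j<h = mod-trans (mod-sym (residue≡ (suc j))) (fold-sign (residue<p (suc j)))

  t-injective : ∀ {i j} → i < h → j < h → t i ≡ t j → i ≡ j
  t-injective {i} {j} i<h j<h ti≡tj = from-roots (square-roots-mod p-prime squares)
    where
    squared : ∀ {j} → j < h → (a * a) * (+ suc j * + suc j) ≡ + t j * + t j mod p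
    squared {j} j<h = begin
      (a * a) * (+ suc j * + suc j)
        ≡⟨ interchange a a (+ suc j) (+ suc j) ⟩
      (a * + suc j) * (a * + suc j)
        ≈⟨ *-cong-mod (a[1+j]≡±t j<h) (a[1+j]≡±t j<h) ⟩
      (sign (upper j) * + t j) * (sign (upper j) * + t j)
        ≡⟨ interchange (sign (upper j)) (+ t j) (sign (upper j)) (+ t j) ⟩
      (sign (upper j) * sign (upper j)) * (+ t j * + t j)
        ≡⟨ cong (_* (+ t j * + t j)) (sign-squared (upper j)) ⟩
      1ℤ * (+ t j * + t j)
        ≡⟨ ℤ.*-identityˡ _ ⟩
      + t j * + t j ∎
      where
      open ≡-mod-Reasoning p
      interchange : ∀ a b c d → (a * b) * (c * d) ≡ (a * c) * (b * d)
      interchange = solve-∀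
    aa≢0 : ¬ (a * a ≡ 0ℤ mod p)
    aa≢0 = Sum.[ a≢0 , a≢0 ] ∘ euclid-mod p-prime
    squares : + suc i * + suc i ≡ + suc j * + suc j mod p
    squares = *-cancelˡ-mod p-prime aa≢0
      (mod-trans (squared i<h)
        (mod-trans (mod-reflexive (cong₂ (λ u v → + u * + v) ti≡tj ti≡tj)) (mod-sym (squared j<h))))
    from-roots : + suc i ≡ + suc j mod p ⊎ + suc i ≡ - + suc j mod p → i ≡ j
    from-roots (inj₁ 1+i≡1+j)  = ℕ.suc-injective (residue-unique (1+j<p i<h) (1+j<p j<h) 1+i≡1+j)
    from-roots (inj₂ 1+i≡-1-j) = contradiction
      (residue-unique (1+j<p i<h) (ℕ.∸-monoʳ-< (s≤s z≤n) (ℕ.<⇒≤ (1+j<p j<h)))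
        (mod-trans 1+i≡-1-j (mod-sym (m∸n≡-n-mod (ℕ.<⇒≤ (1+j<p j<h))))))
      (no-opposite i<h j<h)

  suc-pred-t : ∀ {j} → j < h → suc (ℕ.pred (t j)) ≡ t j
  suc-pred-t j<h = ℕ.suc-pred _ {{ℕ.>-nonZero (proj₁ (t-range j<h))}}

  pred∘t-permutes : IsPermutation h (ℕ.pred ∘ t)
  pred∘t-permutes = record
    { maps-below      = λ j<h → subst (_≤ h) (sym (suc-pred-t j<h)) (proj₂ (t-range j<h))
    ; injective-below = λ i<h j<h pred-ti≡pred-tj →
        t-injective i<h j<h (trans (sym (suc-pred-t i<h)) (trans (cong suc pred-ti≡pred-tj) (suc-pred-t j<h)))
    }

  Π-t : Π[< h ] (λ j → + t j) ≡ Π[< h ] (λ j → + suc j)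
  Π-t = trans (Π-cong h (cong +_ ∘ sym ∘ suc-pred-t)) (Π-permute h pred∘t-permutes (λ i → + suc i))

  Σ-t : Σ[< h ] (λ j → + t j) ≡ Σ[< h ] (λ j → + suc j)
  Σ-t = trans (Σ-cong h (cong +_ ∘ sym ∘ suc-pred-t)) (Σ-permute h pred∘t-permutes (λ i → + suc i))

  gauss-lemma : a ^ h ≡ Π[< h ] (sign ∘ upper) mod p
  gauss-lemma = *-cancelˡ-mod p-prime H≢0 (begin
    H * a ^ h                                          ≡⟨ ℤ.*-comm H (a ^ h) ⟩
    a ^ h * H                                          ≡⟨ cong (_* H) (Π-const h a) ⟨
    Π[< h ] (λ _ → a) * H                              ≡⟨ Π-distrib h (λ _ → a) (λ j → + suc j) ⟨
    Π[< h ] (λ j → a * + suc j)                        ≈⟨ Π-cong-mod h a[1+j]≡±t ⟩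
    Π[< h ] (λ j → sign (upper j) * + t j)             ≡⟨ Π-distrib h (sign ∘ upper) (λ j → + t j) ⟩
    Π[< h ] (sign ∘ upper) * Π[< h ] (λ j → + t j)     ≡⟨ cong (Π[< h ] (sign ∘ upper) *_) Π-t ⟩
    Π[< h ] (sign ∘ upper) * H                         ≡⟨ ℤ.*-comm _ H ⟩
    H * Π[< h ] (sign ∘ upper)                         ∎)
    where
    open ≡-mod-Reasoning p
    H : ℤ
    H = Π[< h ] (λ j → + suc j)
    H≢0 : ¬ (H ≡ 0ℤ mod p)
    H≢0 = Π-≢0-mod p-prime h _ (λ j<h → nonzero-residue (s≤s z≤n) (1+j<p j<h))

  residue-sum-parity : ∀ {k} → h ≡ 2 ℕ.* k →
                       Σ[< p ] (λ μ → + μ * + residue μ) ≡ Σ[< h ] (indicator ∘ upper) mod 2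
  residue-sum-parity {k} h≡2k = begin
    Σ[< p ] G
      ≡⟨ Σ-opposite-pairs G ⟩
    G 0 + Σ[< h ] (λ j → G (suc j) + G (p ℕ.∸ suc j))
      ≡⟨ ℤ.+-identityˡ _ ⟩
    Σ[< h ] (λ j → G (suc j) + G (p ℕ.∸ suc j))
      ≈⟨ Σ-cong-mod h opposite-pair ⟩
    Σ[< h ] (λ j → (1ℤ + (+ suc j + + t j)) + indicator (upper j))
      ≡⟨ Σ-distrib h _ _ ⟩
    Σ[< h ] (λ j → 1ℤ + (+ suc j + + t j)) + N
      ≈⟨ +-cong-mod even-part (mod-refl {x = N}) ⟩
    0ℤ + N
      ≡⟨ ℤ.+-identityˡ N ⟩
    N ∎
    where
    open ≡-mod-Reasoning 2
    G : ℕ → ℤ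
    G μ = + μ * + residue μ
    N : ℤ
    N = Σ[< h ] (indicator ∘ upper)
    opposite-pair : ∀ {j} → j < h →
                    G (suc j) + G (p ℕ.∸ suc j) ≡ (1ℤ + (+ suc j + + t j)) + indicator (upper j) mod 2
    opposite-pair {j} j<h = begin
      G (suc j) + G (p ℕ.∸ suc j)
        ≡⟨ cong (λ r → G (suc j) + + (p ℕ.∸ suc j) * + r) (residue-opposite (s≤s z≤n) (1+j<p j<h)) ⟩
      + suc j * + r + + (p ℕ.∸ suc j) * + (p ℕ.∸ r)
        ≈⟨ opposite-pair-parity (ℕ.<⇒≤ (1+j<p j<h)) (ℕ.<⇒≤ (residue<p (suc j))) ⟩
      1ℤ + (+ suc j + + r)
        ≈⟨ +-cong-mod (mod-refl {x = 1ℤ}) (+-cong-mod (mod-refl {x = + suc j}) (fold-parity (residue<p (suc j)))) ⟩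
      1ℤ + (+ suc j + (+ t j + indicator (upper j)))
        ≡⟨ reassociate 1ℤ (+ suc j) (+ t j) (indicator (upper j)) ⟩
      (1ℤ + (+ suc j + + t j)) + indicator (upper j) ∎
      where
      r : ℕ
      r = residue (suc j)
      reassociate : ∀ a b c d → a + (b + (c + d)) ≡ (a + (b + c)) + d
      reassociate = solve-∀
    even-part : Σ[< h ] (λ j → 1ℤ + (+ suc j + + t j)) ≡ 0ℤ mod 2
    even-part = begin
      Σ[< h ] (λ j → 1ℤ + (+ suc j + + t j))
        ≡⟨ Σ-distrib h _ _ ⟩
      Σ[< h ] (λ _ → 1ℤ) + Σ[< h ] (λ j → + suc j + + t j)
        ≡⟨ cong₂ _+_ (Σ-const h 1ℤ) (Σ-distrib h _ _) ⟩
      + h * 1ℤ + (Σ[< h ] (λ j → + suc j) + Σ[< h ] (λ j → + t j))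
        ≡⟨ cong₂ (λ u v → u * 1ℤ + (Σ[< h ] (λ j → + suc j) + v)) (trans (cong +_ h≡2k) (ℤ.pos-* 2 k)) Σ-t ⟩
      + 2 * + k * 1ℤ + (Σ[< h ] (λ j → + suc j) + Σ[< h ] (λ j → + suc j))
        ≡⟨ regroup (+ k) (Σ[< h ] (λ j → + suc j)) ⟩
      (+ k + Σ[< h ] (λ j → + suc j)) * + 2
        ≈⟨ multiple≡0-mod (+ k + Σ[< h ] (λ j → + suc j)) ⟩
      0ℤ ∎
      where
      regroup : ∀ k s → + 2 * k * 1ℤ + (s + s) ≡ (k + s) * + 2
      regroup = solve-∀

lemma9p6 : (p : ℕ) .{{_ : ℕ.NonZero p}} → Prime p → p % 4 ≡ 1 →
    (a : ℤ) → gcd a (+ p) ≡ 1ℤ →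
    (+ 2) ∣ (S p a 0ℤ - ((legendre p a - 1ℤ) /ℕ 2))
lemma9p6 p p-prime p≡1[4] a gcd≡1 = Signed.∣⇒∣ᵤ (≡-mod⇒∣ (begin
  S p a 0ℤ
    ≈⟨ S-parity a ⟩
  Σ[< p ] (λ μ → + μ * + residue μ)
    ≈⟨ residue-sum-parity {k} refl ⟩
  Σ[< h ] (indicator ∘ upper)           ≈⟨ sign-count-parity h upper (1≢-1-mod 2<p) (legendre-±1 a≢0)
                                              (mod-trans (euler-criterion {h = h} p-prime p≡1+2h a≢0) gauss-lemma) ⟩
  (legendre p a - 1ℤ) /ℕ 2 ∎))
  where
  open ≡-mod-Reasoning 2
  k h : ℕ
  k = p ℕ./ 4
  h = 2 ℕ.* k
  p≡1+2h : p ≡ suc (2 ℕ.* h)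
  p≡1+2h = trans (ℕ.m≡m%n+[m/n]*n p 4) (cong₂ ℕ._+_ p≡1[4] (trans (ℕ.*-comm k 4) (ℕ.*-assoc 2 2 k)))
  1<p : 1 < p
  1<p = ℕ.nonTrivial⇒n>1 p {{prime⇒nonTrivial p-prime}}
  2<p : 2 < p
  2<p = ℕ.≤∧≢⇒< 1<p λ { refl → contradiction p≡1[4] λ () }
  a≢0 : ¬ (a ≡ 0ℤ mod p)
  a≢0 = gcd≡1⇒≢0-mod gcd≡1 (ℕ.>⇒≢ 1<p)
  open OddModulus {p} {h} p≡1+2h
  open Gauss {p} {h} p-prime p≡1+2h a≢0
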